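{- Let $w\geqslant 2$ and $h=2^d$ with $d\in\mathbb{N}$. Then the set $\mathcal{H}_{h,w}$ of FHT patterns has exactly $|\mathcal{H}_{h,w}|=w\cdot h$ elements.
   Context: An image of height $h$ and width $w\geqslant 2$ consists of pixels $p_{ij}$, $i=0,\dots,h-1$ (row, counted from the bottom), $j=0,\dots,w-1$ (column). For a set $T$ of pixels that contains exactly one pixel in each of its rows, let $j_{top}$ and $j_{bot}$ be the column indices of its pixel in its highest and lowest row, and let $\Delta(T)=(j_{top}-j_{bot}) \bmod w$. For integers $a,b$ let $\mathit{tran}_{a,b}(T)=\{p_{i+a,\,(j+b)\bmod w}\mid p_{ij}\in T\}$. Define $\mathcal{H}_0=\{\{p_{00}\},\{p_{01}\},\dots,\{p_{0,w-1}\}\}$ and, for $k=1,\dots,d$, $\mathcal{H}_k=\{T\cup \mathit{tran}_{2^{k-1},\,\Delta(T)+s}(T)\mid T\in\mathcal{H}_{k-1},\ s\in\{0,1\}\}$. For $h=2^d$ the set of FHT patterns is $\mathcal{H}_{h,w}=\mathcal{H}_d$. -}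

module Defs where

open import Data.Nat using (ℕ; zero; suc; _+_; _*_; _∸_; _^_; _≤ᵇ_; NonZero)
open import Data.Nat.DivMod using (_%_)
open import Data.Fin using (toℕ)
open import Data.List using (List; []; _∷_; [_]; _++_; map; concatMap; length; allFin)
open import Data.List.Membership.Propositional using (_∈_)
open import Data.List.Relation.Binary.Subset.Propositional using (_⊆_)
open import Data.List.Relation.Binary.BagAndSetEquality using (_∼[_]_; set)
open import Data.List.Relation.Unary.AllPairs using (AllPairs)
open import Data.List.Relation.Unary.Any using (Any)
open import Data.Bool using (if_then_else_)
open import Data.Product using (_×_; _,_; proj₁; proj₂; ∃)
open import Relation.Nullary using (¬_)
open import Relation.Binary.PropositionalEquality using (_≡_)

-- A pixel p_ij is the pair (i , j): i = row (from the bottom), j = column.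
Pixel : Set
Pixel = ℕ × ℕ

row col : Pixel → ℕ
row = proj₁
col = proj₂

-- A finite set of pixels is represented by a list; two such sets are equal
-- iff the lists are set-equal (same members).  Union is list append.
PixelSet : Set
PixelSet = List Pixel

-- pixel of T in its highest row / lowest row
-- (T has exactly one pixel per row for all sets to which this is applied)
topPix : PixelSet → Pixel
topPix []           = (0 , 0)
topPix (p ∷ [])     = p
topPix (p ∷ q ∷ ps) = let t = topPix (q ∷ ps) in
                      if row t ≤ᵇ row p then p else t

botPix : PixelSet → Pixel
botPix []           = (0 , 0)
botPix (p ∷ [])     = p
botPix (p ∷ q ∷ ps) = let b = botPix (q ∷ ps) in
                      if row p ≤ᵇ row b then p else b

module _ (w : ℕ) .{{_ : NonZero w}} where

  jtop jbot : PixelSet → ℕ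
  jtop T = col (topPix T)
  jbot T = col (botPix T)

  -- Δ(T) = (j_top - j_bot) mod w   (adding w keeps the natural subtraction exact,
  -- since 0 ≤ j_bot < w for all pixels under consideration)
  Δ : PixelSet → ℕ
  Δ T = ((jtop T + w) ∸ jbot T) % w

  tran : ℕ → ℕ → PixelSet → PixelSet
  tran a b T = map (λ p → (row p + a , (col p + b) % w)) T

  -- The generated family 𝓗_k, as a list of pixel sets (possibly with
  -- repetitions up to set equality).
  𝓗 : ℕ → List PixelSet
  𝓗 zero    = map (λ j → [ (0 , toℕ j) ]) (allFin w)
  𝓗 (suc k) = concatMap (λ T → map (λ s → T ++ tran (2 ^ k) (Δ T + s) T) (0 ∷ 1 ∷ [])) (𝓗 k)

  FHT : ℕ → List PixelSet
  FHT d = 𝓗 d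

-- The family F, viewed as a set of pixel sets (elements identified up to
-- set equality), has exactly n elements: there is a list U of n members of F,
-- pairwise distinct as sets, such that every member of F equals (as a set)
-- some element of U.
HasCard : List PixelSet → ℕ → Set
HasCard F n = ∃ λ (U : List PixelSet) →
    U ⊆ F
  × (∀ {T} → T ∈ F → Any (λ S → T ∼[ set ] S) U)
  × AllPairs (λ S S′ → ¬ (S ∼[ set ] S′)) U
  × length U ≡ n

module Submission where

-- The list 𝓗 k has w · 2^k entries by construction (w singletons, and every
-- entry has two children), so the theorem amounts to showing that no two
-- entries of 𝓗 k are equal as sets.  We prove this by induction on k,
-- carrying the invariant "Shape k T": all pixels of T lie in rows < 2^k, and
-- T has exactly one pixel (0 , j₀) in row 0.  The children of T are
-- ext b T = T ∪ tran_{2^k,b}(T) for b = Δ(T) and b = Δ(T) + 1, and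
--   * the lower half of ext b T (rows < 2^k) is exactly T, so children of
--     different parents are different (ext-injective);
--   * the only pixel of ext b T in row 2^k is (2^k , (j₀ + b) mod w), and
--     (j₀ + b + 1) mod w ≠ (j₀ + b) mod w because w ≥ 2, so the two children
--     of one parent are different (ext-separates).

open import Defs
open import Data.Nat using (ℕ; zero; suc; _+_; _*_; _^_; _≤_; _<_; s≤s; z≤n; NonZero)
open import Data.Nat.Properties
open import Data.Nat.DivMod using (_%_; %-pred-≡0; [1+m%d]≤1+n⇒[m%d]≤n)
open import Data.Fin using (Fin; toℕ)
open import Data.Fin.Properties using (toℕ-injective)
open import Data.List using (List; []; _∷_; [_]; _++_; map; concatMap; length; allFin)
open import Data.List.Properties using (length-map; length-++; length-tabulate)
open import Data.List.Membership.Propositional using (_∈_)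
open import Data.List.Membership.Propositional.Properties using (∈-map⁻; ∈-map⁺; ∈-++⁻; ∈-++⁺ˡ; ∈-++⁺ʳ)
open import Data.List.Relation.Unary.Any using (here)
import Data.List.Relation.Unary.Any as Any
open import Data.List.Relation.Unary.All using (All; []; _∷_)
import Data.List.Relation.Unary.All as All
import Data.List.Relation.Unary.All.Properties as All
open import Data.List.Relation.Unary.AllPairs using (AllPairs; []; _∷_)
import Data.List.Relation.Unary.AllPairs as AllPairs
import Data.List.Relation.Unary.AllPairs.Properties as AllPairs
open import Data.List.Relation.Unary.Unique.Propositional.Properties using (allFin⁺)
open import Data.List.Relation.Binary.BagAndSetEquality using (_∼[_]_; set)
open import Data.Product using (_×_; _,_; ∃)
open import Data.Sum using (inj₁; inj₂)
open import Data.Empty using (⊥-elim)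
open import Relation.Nullary using (¬_)
open import Relation.Binary.PropositionalEquality using (_≡_; _≢_; refl; sym; trans; cong; cong₂; subst; module ≡-Reasoning)
open import Function using (id)
open import Function.Bundles using (mk⇔; Equivalence)
open import Function.Related.Propositional using (K-refl)

-- Adding one always changes a residue modulo w ≥ 2; this is what makes the
-- shifts Δ(T) and Δ(T) + 1 produce different patterns.  If x mod w = 0, a
-- residue 0 for x + 1 would force x mod w = w - 1 ≥ 1; if x mod w = r + 1 > 0,
-- equal residues give x mod w ≤ r.
suc-%-≢ : ∀ {w} .{{_ : NonZero w}} → 2 ≤ w → ∀ x → suc x % w ≢ x % w
suc-%-≢ {w} 2≤w x eq with x % w in x%w≡
... | zero  = <-irrefl (sym (trans (sym (%-pred-≡0 eq)) x%w≡)) (∸-monoˡ-≤ 1 2≤w)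
... | suc r = <-irrefl refl (subst (_≤ r) x%w≡ x%w≤r)
  where
    x%w≤r : x % w ≤ r
    x%w≤r = [1+m%d]≤1+n⇒[m%d]≤n x r w (subst (0 <_) (sym eq) (s≤s z≤n)) (≤-reflexive eq)

concatMap-AllPairs : ∀ {A B : Set} {P : A → Set} {S : A → A → Set} {R : B → B → Set}
  (f : A → List B) →
  (∀ {x} → P x → AllPairs R (f x)) →
  (∀ {x y} → P x → P y → S x y → All (λ a → All (R a) (f y)) (f x)) →
  ∀ {xs} → All P xs → AllPairs S xs → AllPairs R (concatMap f xs)
concatMap-AllPairs f inner cross [] [] = []
concatMap-AllPairs f inner cross (px ∷ pxs) (sx ∷ sxs) =
  AllPairs.++⁺ (inner px) (concatMap-AllPairs f inner cross pxs sxs)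
    (All.map (λ q → All.concat⁺ (All.map⁺ q))
      (All.All-swap (All.zipWith (λ (py , s) → cross px py s) (pxs , sx))))

length-concatMap : ∀ {A B : Set} (f : A → List B) {n} → (∀ x → length (f x) ≡ n) →
  ∀ xs → length (concatMap f xs) ≡ length xs * n
length-concatMap f fx≡n [] = refl
length-concatMap f {n} fx≡n (x ∷ xs) = begin
  length (f x ++ concatMap f xs)          ≡⟨ length-++ (f x) ⟩
  length (f x) + length (concatMap f xs)  ≡⟨ cong₂ _+_ (fx≡n x) (length-concatMap f fx≡n xs) ⟩
  n + length xs * n                       ∎
  where open ≡-Reasoning

_≁_ : PixelSet → PixelSet → Set
S ≁ S′ = ¬ (S ∼[ set ] S′)

distinct⇒HasCard : ∀ {F} → AllPairs _≁_ F → HasCard F (length F)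
distinct⇒HasCard {F} distinct = F , id , Any.map (λ { refl → K-refl }) , distinct , refl

module Patterns (w : ℕ) .{{_ : NonZero w}} where

  ext : ℕ → ℕ → PixelSet → PixelSet
  ext k b T = T ++ tran w (2 ^ k) b T

  children : ℕ → PixelSet → List PixelSet
  children k T = map (λ s → ext k (Δ w T + s) T) (0 ∷ 1 ∷ [])

  Bounded : ℕ → PixelSet → Set
  Bounded k T = ∀ {p} → p ∈ T → row p < 2 ^ k

  BottomAt : ℕ → PixelSet → Set
  BottomAt j₀ T = (0 , j₀) ∈ T × (∀ {p} → p ∈ T → row p ≡ 0 → col p ≡ j₀)

  Shape : ℕ → PixelSet → Set
  Shape k T = Bounded k T × ∃ λ j₀ → BottomAt j₀ T

  ∈-tran⁻ : ∀ {a b T p} → p ∈ tran w a b T → ∃ λ q → q ∈ T × p ≡ (row q + a , (col q + b) % w)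
  ∈-tran⁻ = ∈-map⁻ _

  ext-lower : ∀ k {b T p} → p ∈ ext k b T → row p < 2 ^ k → p ∈ T
  ext-lower k {T = T} p∈ext p<2^k with ∈-++⁻ T p∈ext
  ... | inj₁ p∈T = p∈T
  ... | inj₂ p∈tran with ∈-tran⁻ p∈tran
  ... | q , _ , refl = ⊥-elim (<-irrefl refl (≤-trans p<2^k (m≤n+m (2 ^ k) (row q))))

  ext-injective : ∀ k {b b′ T T′} → Bounded k T → Bounded k T′ →
                  ext k b T ∼[ set ] ext k b′ T′ → T ∼[ set ] T′
  ext-injective k bT bT′ eq = mk⇔
    (λ p∈T  → ext-lower k (Equivalence.to   eq (∈-++⁺ˡ p∈T))  (bT p∈T))
    (λ p∈T′ → ext-lower k (Equivalence.from eq (∈-++⁺ˡ p∈T′)) (bT′ p∈T′))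

  ext-row-2^k : ∀ k {b T j₀ p} → Bounded k T → BottomAt j₀ T →
                p ∈ ext k b T → row p ≡ 2 ^ k → col p ≡ (j₀ + b) % w
  ext-row-2^k k {b} {T} {j₀} bT (_ , unique) p∈ext row≡ with ∈-++⁻ T p∈ext
  ... | inj₁ p∈T = ⊥-elim (<-irrefl row≡ (bT p∈T))
  ... | inj₂ p∈tran with ∈-tran⁻ p∈tran
  ... | q , q∈T , refl = cong (λ j → (j + b) % w) (unique q∈T (+-cancelʳ-≡ (2 ^ k) (row q) 0 row≡))

  ext-separates : 2 ≤ w → ∀ k {T} b → Shape k T → ext k b T ≁ ext k (suc b) T
  ext-separates 2≤w k {T} b (bT , j₀ , bottom@(j₀∈T , _)) eq =
    suc-%-≢ 2≤w (j₀ + b) (begin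
      suc (j₀ + b) % w   ≡⟨ cong (_% w) (+-suc j₀ b) ⟨
      -- the top copy of (0 , j₀) in the (b+1)-extension, seen in the b-extension
      (j₀ + suc b) % w   ≡⟨ ext-row-2^k k bT bottom shifted refl ⟩
      (j₀ + b) % w       ∎)
    where
      open ≡-Reasoning
      shifted : (0 + 2 ^ k , (j₀ + suc b) % w) ∈ ext k b T
      shifted = Equivalence.from eq (∈-++⁺ʳ T (∈-map⁺ _ j₀∈T))

  siblings-distinct : 2 ≤ w → ∀ k {T} → Shape k T → AllPairs _≁_ (children k T)
  siblings-distinct 2≤w k {T} shape = (separated ∷ []) ∷ [] ∷ []
    where
      separated : ext k (Δ w T + 0) T ≁ ext k (Δ w T + 1) T
      separated rewrite +-identityʳ (Δ w T) | +-comm (Δ w T) 1 = ext-separates 2≤w k (Δ w T) shape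

  cousins-distinct : ∀ k {T T′} → Bounded k T → Bounded k T′ → T ≁ T′ →
                     All (λ S → All (S ≁_) (children k T′)) (children k T)
  cousins-distinct k {T} {T′} bT bT′ T≁T′ = (apart ∷ apart ∷ []) ∷ (apart ∷ apart ∷ []) ∷ []
    where
      apart : ∀ {b b′} → ext k b T ≁ ext k b′ T′
      apart eq = T≁T′ (ext-injective k bT bT′ eq)

  ext-shape : ∀ k {b T} → Shape k T → Shape (suc k) (ext k b T)
  ext-shape k {b} {T} (bT , j₀ , j₀∈T , unique) = bounded , j₀ , ∈-++⁺ˡ j₀∈T , unique′
    where
      2^k+2^k≡ : 2 ^ k + 2 ^ k ≡ 2 ^ suc k
      2^k+2^k≡ = cong (2 ^ k +_) (sym (+-identityʳ (2 ^ k)))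
      bounded : Bounded (suc k) (ext k b T)
      bounded p∈ext with ∈-++⁻ T p∈ext
      ... | inj₁ p∈T = ≤-trans (bT p∈T) (≤-trans (m≤m+n (2 ^ k) (2 ^ k)) (≤-reflexive 2^k+2^k≡))
      ... | inj₂ p∈tran with ∈-tran⁻ p∈tran
      ... | q , q∈T , refl = ≤-trans (+-monoˡ-< (2 ^ k) (bT q∈T)) (≤-reflexive 2^k+2^k≡)
      unique′ : ∀ {p} → p ∈ ext k b T → row p ≡ 0 → col p ≡ j₀
      unique′ p∈ext row≡0 with ∈-++⁻ T p∈ext
      ... | inj₁ p∈T = unique p∈T row≡0
      ... | inj₂ p∈tran with ∈-tran⁻ p∈tran
      ... | q , _ , refl = ⊥-elim (<-irrefl (sym (m+n≡0⇒n≡0 (row q) row≡0)) (m^n>0 2 k))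

  𝓗-shape : ∀ k → All (Shape k) (𝓗 w k)
  𝓗-shape zero = All.map⁺ (All.tabulate singleton-shape)
    where
      singleton-shape : ∀ {j} → j ∈ allFin w → Shape 0 [ (0 , toℕ j) ]
      singleton-shape _ = (λ { (here refl) → s≤s z≤n }) , _ , here refl , λ { (here refl) _ → refl }
  𝓗-shape (suc k) = All.concat⁺ (All.map⁺ (All.map (λ s → ext-shape k s ∷ ext-shape k s ∷ []) (𝓗-shape k)))

  𝓗-distinct : 2 ≤ w → ∀ k → AllPairs _≁_ (𝓗 w k)
  𝓗-distinct _ zero = AllPairs.map⁺ (AllPairs.map different-columns (allFin⁺ w))
    where
      different-columns : ∀ {j j′ : Fin w} → j ≢ j′ → [ (0 , toℕ j) ] ≁ [ (0 , toℕ j′) ]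
      different-columns j≢j′ eq with Equivalence.to eq (here refl)
      ... | here e = j≢j′ (toℕ-injective (cong col e))
  𝓗-distinct 2≤w (suc k) =
    concatMap-AllPairs (children k) (siblings-distinct 2≤w k)
      (λ (bT , _) (bT′ , _) → cousins-distinct k bT bT′) (𝓗-shape k) (𝓗-distinct 2≤w k)

  𝓗-length : ∀ k → length (𝓗 w k) ≡ w * 2 ^ k
  𝓗-length zero = begin
    length (𝓗 w 0)     ≡⟨ length-map _ (allFin w) ⟩
    length (allFin w)  ≡⟨ length-tabulate id ⟩
    w                  ≡⟨ *-identityʳ w ⟨
    w * 1              ∎
    where open ≡-Reasoning
  𝓗-length (suc k) = begin
    length (𝓗 w (suc k))  ≡⟨ length-concatMap (children k) (λ _ → refl) (𝓗 w k) ⟩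
    length (𝓗 w k) * 2    ≡⟨ cong (_* 2) (𝓗-length k) ⟩
    w * 2 ^ k * 2         ≡⟨ *-assoc w (2 ^ k) 2 ⟩
    w * (2 ^ k * 2)       ≡⟨ cong (w *_) (*-comm (2 ^ k) 2) ⟩
    w * 2 ^ suc k         ∎
    where open ≡-Reasoning

proposition6 : (w d : ℕ) → .{{_ : NonZero w}} → 2 ≤ w → HasCard (FHT w d) (w * 2 ^ d)
proposition6 w d 2≤w =
  subst (HasCard (FHT w d)) (𝓗-length d) (distinct⇒HasCard (𝓗-distinct 2≤w d))
  where open Patterns w
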